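{- $\mathsf{HS}_{\mathsf{lin}}$ is at least exponentially more succinct than $\mathsf{LTL}$, in the following sense: there exists a sequence $(\psi_n)_{n\ge1}$ of $\mathsf{HS}$ formulas such that for every polynomial $P$ there is $n$ for which no $\mathsf{LTL}$ formula $\varphi$ with $|\varphi|\le P(|\psi_n|)$ satisfies, for every finite Kripke structure $K$, $K\models_{\mathsf{lin}}\psi_n\iff K\models\varphi$.
   Context: A Kripke structure over a finite set $\mathcal{AP}$ is $K=(\mathcal{AP},S,\delta,\mu,s_0)$ with states $S$, left-total $\delta\subseteq S\times S$, labelling $\mu:S\to2^{\mathcal{AP}}$, initial state $s_0$; finite if $S$ is finite. Infinite paths follow $\delta$; initial if they start at $s_0$. $\mathsf{HS}$ formulas: $\psi::=p\mid\neg\psi\mid\psi\wedge\psi\mid\langle B\rangle\psi\mid\langle E\rangle\psi\mid\langle\overline{B}\rangle\psi\mid\langle\overline{E}\rangle\psi$. Trace-based semantics: an infinite path $\pi$ induces intervals $[i,j]$ ($i\le j$) labelled $\sigma([i,j])=\bigcap_{h=i}^{j}\mu(\pi(h))$; $[i,j]\models p$ iff $p\in\sigma([i,j])$; $\langle B\rangle$: some $[i,j']$, $i\le j'<j$; $\langle E\rangle$: some $[i',j]$, $i<i'\le j$; $\langle\overline{B}\rangle$: some $[i,j']$, $j'>j$; $\langle\overline{E}\rangle$: some $[i',j]$, $i'<i$. $K\models_{\mathsf{lin}}\psi$ iff for every initial infinite path $\pi$ and every $i\ge0$, $[0,i]\models\psi$. $\mathsf{LTL}$: $\varphi::=\top\mid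 p\mid\neg\varphi\mid\varphi\wedge\varphi\mid\mathsf{X}\varphi\mid\varphi\,\mathsf{U}\,\varphi$, standard semantics on infinite paths; $K\models\varphi$ iff $\pi,0\models\varphi$ for all initial infinite paths $\pi$. The size $|\cdot|$ of a formula is its number of symbols. -}

module Defs where

open import Data.Nat using (ℕ; zero; suc; _+_; _*_; _^_; _≤_; _<_)
open import Data.Fin using (Fin)
open import Data.Bool using (Bool; true)
open import Data.List using (List; []; _∷_)
open import Data.Product using (Σ; ∃; _×_; _,_)
open import Data.Unit using (⊤)
open import Relation.Nullary using (¬_)
open import Relation.Binary.PropositionalEquality using (_≡_)
open import Function.Bundles using (_⇔_)

-- Finite Kripke structures over the finite set of propositions Fin m.
-- States are Fin k (any finite state set is in bijection with some Fin k).

record Kripke (m : ℕ) : Set where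
  field
    nStates : ℕ
    δ       : Fin nStates → Fin nStates → Bool
    total   : ∀ s → ∃ λ t → δ s t ≡ true
    μ       : Fin nStates → Fin m → Bool
    s₀      : Fin nStates

open Kripke public

IsPath : ∀ {m} (K : Kripke m) → (ℕ → Fin (nStates K)) → Set
IsPath K π = ∀ i → δ K (π i) (π (suc i)) ≡ true

IsInitialPath : ∀ {m} (K : Kripke m) → (ℕ → Fin (nStates K)) → Set
IsInitialPath K π = (π 0 ≡ s₀ K) × IsPath K π

data HS (m : ℕ) : Set where
  prop : Fin m → HS m
  ¬ₕ_  : HS m → HS m
  _∧ₕ_ : HS m → HS m → HS m
  ⟨B⟩  : HS m → HS m
  ⟨E⟩  : HS m → HS m
  ⟨B̅⟩  : HS m → HS m
  ⟨E̅⟩  : HS m → HS m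

sizeHS : ∀ {m} → HS m → ℕ
sizeHS (prop p)  = 1
sizeHS (¬ₕ ψ)    = suc (sizeHS ψ)
sizeHS (ψ ∧ₕ χ)  = suc (sizeHS ψ + sizeHS χ)
sizeHS (⟨B⟩ ψ)   = suc (sizeHS ψ)
sizeHS (⟨E⟩ ψ)   = suc (sizeHS ψ)
sizeHS (⟨B̅⟩ ψ)   = suc (sizeHS ψ)
sizeHS (⟨E̅⟩ ψ)   = suc (sizeHS ψ)

-- Trace-based semantics: interval [i,j] (i ≤ j) of the path π.
-- p ∈ σ([i,j]) iff p ∈ μ(π h) for all i ≤ h ≤ j.
module _ {m : ℕ} (K : Kripke m) (π : ℕ → Fin (nStates K)) where
  _,_⊨HS_ : ℕ → ℕ → HS m → Set
  i , j ⊨HS prop p  = ∀ h → i ≤ h → h ≤ j → μ K (π h) p ≡ true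
  i , j ⊨HS (¬ₕ ψ)   = ¬ (i , j ⊨HS ψ)
  i , j ⊨HS (ψ ∧ₕ χ) = (i , j ⊨HS ψ) × (i , j ⊨HS χ)
  i , j ⊨HS (⟨B⟩ ψ)  = ∃ λ j' → i ≤ j' × j' < j × (i , j' ⊨HS ψ)
  i , j ⊨HS (⟨E⟩ ψ)  = ∃ λ i' → i < i' × i' ≤ j × (i' , j ⊨HS ψ)
  i , j ⊨HS (⟨B̅⟩ ψ)  = ∃ λ j' → j < j' × (i , j' ⊨HS ψ)
  i , j ⊨HS (⟨E̅⟩ ψ)  = ∃ λ i' → i' < i × (i' , j ⊨HS ψ)

_⊨lin_ : ∀ {m} → Kripke m → HS m → Set
K ⊨lin ψ = ∀ (π : ℕ → Fin (nStates K)) → IsInitialPath K π → ∀ i → _,_⊨HS_ K π 0 i ψ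

data LTL (m : ℕ) : Set where
  ⊤ₗ   : LTL m
  prop : Fin m → LTL m
  ¬ₗ_  : LTL m → LTL m
  _∧ₗ_ : LTL m → LTL m → LTL m
  X    : LTL m → LTL m
  _U_  : LTL m → LTL m → LTL m

sizeLTL : ∀ {m} → LTL m → ℕ
sizeLTL ⊤ₗ        = 1
sizeLTL (prop p)  = 1
sizeLTL (¬ₗ φ)    = suc (sizeLTL φ)
sizeLTL (φ ∧ₗ χ)  = suc (sizeLTL φ + sizeLTL χ)
sizeLTL (X φ)     = suc (sizeLTL φ)
sizeLTL (φ U χ)   = suc (sizeLTL φ + sizeLTL χ)

module _ {m : ℕ} (K : Kripke m) (π : ℕ → Fin (nStates K)) where
  _⊨LTL_ : ℕ → LTL m → Set
  i ⊨LTL ⊤ₗ       = ⊤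
  i ⊨LTL prop p   = μ K (π i) p ≡ true
  i ⊨LTL (¬ₗ φ)   = ¬ (i ⊨LTL φ)
  i ⊨LTL (φ ∧ₗ χ) = (i ⊨LTL φ) × (i ⊨LTL χ)
  i ⊨LTL X φ      = suc i ⊨LTL φ
  i ⊨LTL (φ U χ)  = ∃ λ k → i ≤ k × (k ⊨LTL χ) × (∀ j → i ≤ j → j < k → j ⊨LTL φ)

_⊨_ : ∀ {m} → Kripke m → LTL m → Set
K ⊨ φ = ∀ (π : ℕ → Fin (nStates K)) → IsInitialPath K π → _⊨LTL_ K π 0 φ

-- Polynomials in one variable with natural-number coefficients
-- (coefficient list, lowest degree first).  Every polynomial is bounded
-- on ℕ by one of these, so quantifying over them is no loss.

Poly : Set
Poly = List ℕ

evalPoly : Poly → ℕ → ℕ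
evalPoly []       x = 0
evalPoly (c ∷ cs) x = c + x * evalPoly cs x

-- On a prefix [0, i] of a path, ψ n says that q (proposition zero)
-- holds at the last state whenever that state agrees with the first one on
-- p₁ … pₙ (propositions suc k).  Consider the structures with a single path that
-- reads a valuation v of the pₖ at time 0 and then all 2ⁿ valuations of the pₖ in
-- turn, the j-th one carrying q iff Q j for a set Q ⊆ 2ⁿ: ψ n holds there iff Q
-- contains v.  From time 1 on the path does not depend on v, and the truth of an
-- LTL formula φ at time 0 is determined by the letter at time 0 and by the truth
-- values at time 1 of the |φ| subformulas of φ.  So if φ were equivalent to ψ n,
-- these |φ| bits would determine Q, which is impossible when |φ| < 2ⁿ; and 2ⁿ
-- outgrows every polynomial in |ψ n| = 36n + 15.

module Submission where

open import Defs
open import Data.Nat using (ℕ; zero; suc; _+_; _*_; _^_; _≤_; _<_; _⊓_; z≤n; s≤s; NonZero)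
open import Data.Nat.Properties hiding (_≟_)
open import Data.Nat.Tactic.RingSolver using (solve-∀)
open import Data.Fin using (Fin; zero; suc; toℕ; fromℕ<; funToFin; finToFun; combine)
open import Data.Fin.Properties
  using (_≟_; toℕ-fromℕ<; toℕ-injective; toℕ<n; finToFun-funToFin; funToFin-finToFin; 2↔Bool;
         pigeonhole; sequence; ∀-cons-⇔)
  renaming (<-irrefl to <-irreflᶠ)
open import Data.Bool using (Bool; true; false)
open import Data.Bool.Properties using (⇔→≡) renaming (_≟_ to _≟ᵇ_)
open import Data.Product using (Σ; ∃; _×_; _,_)
open import Data.Product.Function.NonDependent.Propositional using (_×-⇔_)
open import Data.Sum using (_⊎_; inj₁; inj₂)
open import Data.Sum.Function.Propositional using (_⊎-⇔_)
open import Data.Empty using (⊥-elim)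
open import Data.Vec.Functional using (Vector; []; _∷_; _++_)
open import Data.Vec.Functional.Relation.Unary.All using (All)
open import Data.Vec.Functional.Relation.Unary.All.Properties using (++⁻)
open import Effect.Monad using (RawMonad)
open import Function using (_∘_; const)
open import Function.Bundles using (_⇔_; mk⇔; Equivalence; Inverse)
open import Function.Construct.Composition using (_⇔-∘_)
open import Function.Construct.Identity using (⇔-id)
open import Function.Construct.Symmetry using (⇔-sym)
open import Function.Properties.Equivalence using (⇔-setoid)
open import Function.Related.TypeIsomorphisms using (→-cong-⇔; ¬-cong-⇔)
open import Level using (0ℓ)
open import Relation.Nullary using (¬_; Dec; yes; no; does)
open import Relation.Nullary.Decidable using (decidable-stable; dec-true)
import Relation.Nullary.Decidable as Dec
open import Relation.Nullary.Decidable.Core using (¬¬-excluded-middle)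
open import Relation.Nullary.Negation using (¬¬-Monad)
open import Relation.Binary.PropositionalEquality
  using (_≡_; _≗_; refl; sym; trans; cong; cong₂; subst; module ≡-Reasoning)

open Equivalence using (to; from)

infixr 6 _∨ₕ_ _⇒ₕ_ _⇔ₕ_

_∨ₕ_ _⇒ₕ_ _⇔ₕ_ : ∀ {m} → HS m → HS m → HS m
a ∨ₕ b = ¬ₕ ((¬ₕ a) ∧ₕ (¬ₕ b))
a ⇒ₕ b = ¬ₕ (a ∧ₕ (¬ₕ b))
a ⇔ₕ b = (a ⇒ₕ b) ∧ₕ (b ⇒ₕ a)

begins ends : ∀ {m} → Fin m → HS m
begins p = prop p ∨ₕ ⟨B⟩ (prop p)
ends   p = prop p ∨ₕ ⟨E⟩ (prop p)

⊤ₕ : ∀ {m} → HS (suc m)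
⊤ₕ = prop zero ⇒ₕ prop zero

⋀ₕ : ∀ {m k} → (Fin k → HS (suc m)) → HS (suc m)
⋀ₕ {k = zero}  f = ⊤ₕ
⋀ₕ {k = suc k} f = f zero ∧ₕ ⋀ₕ (f ∘ suc)

ψ : (n : ℕ) → HS (suc n)
ψ n = ⋀ₕ (λ k → begins (suc k) ⇔ₕ ends (suc k)) ⇒ₕ ends zero

sizeHS-⋀ₕ : ∀ {m k c} (f : Fin k → HS (suc m)) → (∀ i → sizeHS (f i) ≡ c) →
            sizeHS (⋀ₕ f) ≡ k * suc c + 5
sizeHS-⋀ₕ {k = zero}          f _     = refl
sizeHS-⋀ₕ {k = suc k} {c = c} f sizes rewrite sizes zero | sizeHS-⋀ₕ (f ∘ suc) (sizes ∘ suc) =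
  cong suc (sym (+-assoc c (k * suc c) 5))

sizeHS-ψ≤ : ∀ {n} → 1 ≤ n → sizeHS (ψ n) ≤ 51 * n
sizeHS-ψ≤ {n} 1≤n = begin
  sizeHS (ψ n)                ≡⟨ cong (λ x → 2 + (x + 8)) (sizeHS-⋀ₕ _ (λ _ → refl)) ⟩
  2 + ((n * 36 + 5) + 8)      ≡⟨ normalise n ⟩
  36 * n + 15                 ≤⟨ +-monoʳ-≤ (36 * n) (*-monoʳ-≤ 15 1≤n) ⟩
  36 * n + 15 * n             ≡⟨ *-distribʳ-+ n 36 15 ⟨
  51 * n                      ∎
  where
  open ≤-Reasoning
  normalise : ∀ x → 2 + ((x * 36 + 5) + 8) ≡ 36 * x + 15
  normalise = solve-∀

module HS-Semantics {m : ℕ} (K : Kripke m) (π : ℕ → Fin (nStates K)) where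

  infix 4 _,_⊨ₕ_
  _,_⊨ₕ_ : ℕ → ℕ → HS m → Set
  i , j ⊨ₕ a = _,_⊨HS_ K π i j a

  ⊨-⇒ₕ : ∀ {i j} a b → Dec (i , j ⊨ₕ b) → (i , j ⊨ₕ a ⇒ₕ b) ⇔ (i , j ⊨ₕ a → i , j ⊨ₕ b)
  ⊨-⇒ₕ a b b? = mk⇔ (λ ¬[a∧¬b] a → decidable-stable b? λ ¬b → ¬[a∧¬b] (a , ¬b))
                     (λ a→b (a , ¬b) → ¬b (a→b a))

  ⊨-⇔ₕ : ∀ {i j} a b → Dec (i , j ⊨ₕ a) → Dec (i , j ⊨ₕ b) →
         (i , j ⊨ₕ a ⇔ₕ b) ⇔ (i , j ⊨ₕ a ⇔ i , j ⊨ₕ b)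
  ⊨-⇔ₕ a b a? b? = mk⇔ (λ (a⇒b , b⇒a) → mk⇔ (to (⊨-⇒ₕ a b b?) a⇒b) (to (⊨-⇒ₕ b a a?) b⇒a))
                       (λ a⇔b → from (⊨-⇒ₕ a b b?) (to a⇔b) , from (⊨-⇒ₕ b a a?) (from a⇔b))

  ⊨-prop-point : ∀ {i p} → μ K (π i) p ≡ true → i , i ⊨ₕ prop p
  ⊨-prop-point {i} {p} πᵢ∋p h i≤h h≤i = subst (λ h → μ K (π h) p ≡ true) (≤-antisym i≤h h≤i) πᵢ∋p

  ⊨-begins : ∀ {i j} p → i ≤ j → (i , j ⊨ₕ begins p) ⇔ (μ K (π i) p ≡ true)
  ⊨-begins {i} {j} p i≤j = mk⇔ first∋p first∋p⇒begins
    where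
    first∋p : i , j ⊨ₕ begins p → μ K (π i) p ≡ true
    first∋p ¬[¬a∧¬b] = decidable-stable (μ K (π i) p ≟ᵇ true) λ ¬πᵢ∋p →
      ¬[¬a∧¬b] ( (λ a → ¬πᵢ∋p (a i ≤-refl i≤j))
               , (λ (j′ , i≤j′ , _ , a) → ¬πᵢ∋p (a i ≤-refl i≤j′)))
    first∋p⇒begins : μ K (π i) p ≡ true → i , j ⊨ₕ begins p
    first∋p⇒begins πᵢ∋p (¬a , ¬b) with m≤n⇒m<n∨m≡n i≤j
    ... | inj₁ i<j  = ¬b (i , ≤-refl , i<j , ⊨-prop-point πᵢ∋p)
    ... | inj₂ refl = ¬a (⊨-prop-point πᵢ∋p)

  ⊨-ends : ∀ {i j} p → i ≤ j → (i , j ⊨ₕ ends p) ⇔ (μ K (π j) p ≡ true)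
  ⊨-ends {i} {j} p i≤j = mk⇔ last∋p last∋p⇒ends
    where
    last∋p : i , j ⊨ₕ ends p → μ K (π j) p ≡ true
    last∋p ¬[¬a∧¬b] = decidable-stable (μ K (π j) p ≟ᵇ true) λ ¬πⱼ∋p →
      ¬[¬a∧¬b] ( (λ a → ¬πⱼ∋p (a j i≤j ≤-refl))
               , (λ (i′ , _ , i′≤j , a) → ¬πⱼ∋p (a j i′≤j ≤-refl)))
    last∋p⇒ends : μ K (π j) p ≡ true → i , j ⊨ₕ ends p
    last∋p⇒ends πⱼ∋p (¬a , ¬b) with m≤n⇒m<n∨m≡n i≤j
    ... | inj₁ i<j  = ¬b (j , i<j , ≤-refl , ⊨-prop-point πⱼ∋p)
    ... | inj₂ refl = ¬a (⊨-prop-point πⱼ∋p)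

  ⊨-begins? : ∀ {i j} p → i ≤ j → Dec (i , j ⊨ₕ begins p)
  ⊨-begins? p i≤j = Dec.map (⇔-sym (⊨-begins p i≤j)) (_ ≟ᵇ true)

  ⊨-ends? : ∀ {i j} p → i ≤ j → Dec (i , j ⊨ₕ ends p)
  ⊨-ends? p i≤j = Dec.map (⇔-sym (⊨-ends p i≤j)) (_ ≟ᵇ true)

  ⊨-begins⇔ₕends : ∀ {i j} p → i ≤ j → (i , j ⊨ₕ begins p ⇔ₕ ends p) ⇔ (μ K (π i) p ≡ μ K (π j) p)
  ⊨-begins⇔ₕends {i} {j} p i≤j = mk⇔
    (λ h → ⇔→≡ (⊨-ends p i≤j ⇔-∘ (to semantics h ⇔-∘ ⇔-sym (⊨-begins p i≤j))))
    (λ πᵢ≡πⱼ → from semantics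
      (⇔-sym (⊨-ends p i≤j) ⇔-∘ (mk⇔ (trans (sym πᵢ≡πⱼ)) (trans πᵢ≡πⱼ) ⇔-∘ ⊨-begins p i≤j)))
    where
    semantics : (i , j ⊨ₕ begins p ⇔ₕ ends p) ⇔ (i , j ⊨ₕ begins p ⇔ i , j ⊨ₕ ends p)
    semantics = ⊨-⇔ₕ (begins p) (ends p) (⊨-begins? p i≤j) (⊨-ends? p i≤j)

module _ {n : ℕ} (K : Kripke (suc n)) (π : ℕ → Fin (nStates K)) where
  open HS-Semantics K π

  ⊨-⊤ₕ : ∀ {i j} → i , j ⊨ₕ ⊤ₕ
  ⊨-⊤ₕ (a , ¬a) = ¬a a

  ⊨-⋀ₕ : ∀ {i j k} (f : Fin k → HS (suc n)) → (i , j ⊨ₕ ⋀ₕ f) ⇔ (∀ l → i , j ⊨ₕ f l)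
  ⊨-⋀ₕ {k = zero}  f = mk⇔ (λ _ ()) (λ _ → ⊨-⊤ₕ)
  ⊨-⋀ₕ {k = suc k} f = ∀-cons-⇔ ⇔-∘ (⇔-id _ ×-⇔ ⊨-⋀ₕ (f ∘ suc))

  ⊨-ψ : ∀ {i j} → i ≤ j →
        (i , j ⊨ₕ ψ n) ⇔ ((∀ k → μ K (π i) (suc k) ≡ μ K (π j) (suc k)) → μ K (π j) zero ≡ true)
  ⊨-ψ {i} {j} i≤j = →-cong-⇔ agreement (⊨-ends zero i≤j) ⇔-∘ ⊨-⇒ₕ _ (ends zero) (⊨-ends? zero i≤j)
    where
    agreement : (i , j ⊨ₕ ⋀ₕ (λ k → begins (suc k) ⇔ₕ ends (suc k))) ⇔
                (∀ k → μ K (π i) (suc k) ≡ μ K (π j) (suc k))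
    agreement = mk⇔ (λ h k → to (⊨-begins⇔ₕends (suc k) i≤j) (h k))
                    (λ h k → from (⊨-begins⇔ₕends (suc k) i≤j) (h k))
                ⇔-∘ ⊨-⋀ₕ _

Until : (ℕ → Set) → (ℕ → Set) → ℕ → Set
Until P Q i = ∃ λ k → i ≤ k × Q k × (∀ j → i ≤ j → j < k → P j)

module _ {P Q : ℕ → Set} where

  Until-map : ∀ {P′ Q′ : ℕ → Set} {i} →
              (∀ {k} → i ≤ k → P k → P′ k) → (∀ {k} → i ≤ k → Q k → Q′ k) →
              Until P Q i → Until P′ Q′ i
  Until-map f g (k , i≤k , Qk , P<k) = k , i≤k , g i≤k Qk , λ j i≤j j<k → f i≤j (P<k j i≤j j<k)

  Until-unfold : ∀ {i} → Until P Q i ⇔ (Q i ⊎ (P i × Until P Q (suc i)))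
  Until-unfold {i} = mk⇔ unfold fold
    where
    unfold : Until P Q i → Q i ⊎ (P i × Until P Q (suc i))
    unfold (k , i≤k , Qk , P<k) with m≤n⇒m<n∨m≡n i≤k
    ... | inj₂ refl = inj₁ Qk
    ... | inj₁ i<k  = inj₂ (P<k i ≤-refl i<k , k , i<k , Qk , λ j i<j → P<k j (<⇒≤ i<j))
    fold : Q i ⊎ (P i × Until P Q (suc i)) → Until P Q i
    fold (inj₁ Qi) = i , ≤-refl , Qi , λ j i≤j j<i → ⊥-elim (<-irrefl refl (≤-<-trans i≤j j<i))
    fold (inj₂ (Pi , k , i<k , Qk , P<k)) = k , <⇒≤ i<k , Qk , P≤
      where
      P≤ : ∀ j → i ≤ j → j < k → P j
      P≤ j i≤j j<k with m≤n⇒m<n∨m≡n i≤j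
      ... | inj₂ refl = Pi
      ... | inj₁ i<j  = P<k j i<j j<k

subformulas : ∀ {m} (φ : LTL m) → Vector (LTL m) (sizeLTL φ)
subformulas ⊤ₗ       = ⊤ₗ ∷ []
subformulas (prop p) = prop p ∷ []
subformulas (¬ₗ φ)   = (¬ₗ φ) ∷ subformulas φ
subformulas (φ ∧ₗ χ) = (φ ∧ₗ χ) ∷ (subformulas φ ++ subformulas χ)
subformulas (X φ)    = X φ ∷ subformulas φ
subformulas (φ U χ)  = (φ U χ) ∷ (subformulas φ ++ subformulas χ)

All-subformulas⇒self : ∀ {m} {P : LTL m → Set} φ → All P (subformulas φ) → P φ
All-subformulas⇒self ⊤ₗ       Ps = Ps zero
All-subformulas⇒self (prop p) Ps = Ps zero
All-subformulas⇒self (¬ₗ φ)   Ps = Ps zero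
All-subformulas⇒self (φ ∧ₗ χ) Ps = Ps zero
All-subformulas⇒self (X φ)    Ps = Ps zero
All-subformulas⇒self (φ U χ)  Ps = Ps zero

module _ {m : ℕ} {K K′ : Kripke m} {π : ℕ → Fin (nStates K)} {π′ : ℕ → Fin (nStates K′)} where

  SameLabel : ℕ → Set
  SameLabel i = ∀ p → μ K (π i) p ≡ μ K′ (π′ i) p

  Equisatisfied : ℕ → LTL m → Set
  Equisatisfied i φ = _⊨LTL_ K π i φ ⇔ _⊨LTL_ K′ π′ i φ

  Equisatisfied-prop : ∀ {i} → SameLabel i → ∀ p → Equisatisfied i (prop p)
  Equisatisfied-prop same p = mk⇔ (trans (sym (same p))) (trans (same p))

  ⊨LTL-cong-from : ∀ {a} → (∀ {i} → a ≤ i → SameLabel i) → ∀ {i} → a ≤ i → ∀ φ → Equisatisfied i φ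
  ⊨LTL-cong-from same a≤i ⊤ₗ       = ⇔-id _
  ⊨LTL-cong-from same a≤i (prop p) = Equisatisfied-prop (same a≤i) p
  ⊨LTL-cong-from same a≤i (¬ₗ φ)   = ¬-cong-⇔ (⊨LTL-cong-from same a≤i φ)
  ⊨LTL-cong-from same a≤i (φ ∧ₗ χ) = ⊨LTL-cong-from same a≤i φ ×-⇔ ⊨LTL-cong-from same a≤i χ
  ⊨LTL-cong-from same a≤i (X φ)    = ⊨LTL-cong-from same (m≤n⇒m≤1+n a≤i) φ
  ⊨LTL-cong-from same {i} a≤i (φ U χ)  = mk⇔
    (Until-map (λ i≤k → to (later i≤k φ)) (λ i≤k → to (later i≤k χ)))
    (Until-map (λ i≤k → from (later i≤k φ)) (λ i≤k → from (later i≤k χ)))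
    where
    later : ∀ {k} → i ≤ k → ∀ ξ → Equisatisfied k ξ
    later i≤k = ⊨LTL-cong-from same (≤-trans a≤i i≤k)

  ⊨LTL-cong-step : ∀ {a} → SameLabel a → ∀ φ → All (Equisatisfied (suc a)) (subformulas φ) →
                   Equisatisfied a φ
  ⊨LTL-cong-step same ⊤ₗ       _  = ⇔-id _
  ⊨LTL-cong-step same (prop p) _  = Equisatisfied-prop same p
  ⊨LTL-cong-step same (¬ₗ φ)   Es = ¬-cong-⇔ (⊨LTL-cong-step same φ (Es ∘ suc))
  ⊨LTL-cong-step same (φ ∧ₗ χ) Es =
    let Eφ , Eχ = ++⁻ (Equisatisfied (suc _)) (subformulas φ) (Es ∘ suc)
    in ⊨LTL-cong-step same φ Eφ ×-⇔ ⊨LTL-cong-step same χ Eχ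
  ⊨LTL-cong-step same (X φ)    Es = All-subformulas⇒self {P = Equisatisfied (suc _)} φ (Es ∘ suc)
  ⊨LTL-cong-step same (φ U χ)  Es =
    let Eφ , Eχ = ++⁻ (Equisatisfied (suc _)) (subformulas φ) (Es ∘ suc)
    in ⇔-sym Until-unfold ⇔-∘
       ((⊨LTL-cong-step same χ Eχ ⊎-⇔ (⊨LTL-cong-step same φ Eφ ×-⇔ Es zero)) ⇔-∘ Until-unfold)

does≡true⇒ : ∀ {A : Set} (a? : Dec A) → does a? ≡ true → A
does≡true⇒ (yes a) _ = a

module _ {L : ℕ} where

  lassoPos : ℕ → Fin (suc L)
  lassoPos i = fromℕ< (s≤s (m⊓n≤n i L))

  lassoNext : Fin (suc L) → Fin (suc L)
  lassoNext s = lassoPos (suc (toℕ s))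

  toℕ-lassoPos : ∀ i → toℕ (lassoPos i) ≡ i ⊓ L
  toℕ-lassoPos i = toℕ-fromℕ< (s≤s (m⊓n≤n i L))

  lassoNext-lassoPos : ∀ i → lassoNext (lassoPos i) ≡ lassoPos (suc i)
  lassoNext-lassoPos i = toℕ-injective (begin
    toℕ (lassoNext (lassoPos i))   ≡⟨ toℕ-lassoPos _ ⟩
    suc (toℕ (lassoPos i)) ⊓ L     ≡⟨ cong (λ x → suc x ⊓ L) (toℕ-lassoPos i) ⟩
    (suc i ⊓ suc L) ⊓ L            ≡⟨ ⊓-assoc (suc i) (suc L) L ⟩
    suc i ⊓ (suc L ⊓ L)            ≡⟨ cong (suc i ⊓_) (m≥n⇒m⊓n≡n (n≤1+n L)) ⟩
    suc i ⊓ L                      ≡⟨ toℕ-lassoPos (suc i) ⟨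
    toℕ (lassoPos (suc i))         ∎)
    where open ≡-Reasoning

  lassoPos-suc-toℕ : ∀ (j : Fin L) → lassoPos (suc (toℕ j)) ≡ suc j
  lassoPos-suc-toℕ j = toℕ-injective (trans (toℕ-lassoPos (suc (toℕ j))) (m≤n⇒m⊓n≡m (toℕ<n j)))

lassoPos-suc : ∀ {L} → 0 < L → ∀ i → ∃ λ j → lassoPos {L} (suc i) ≡ suc j
lassoPos-suc {suc L} _ i = _ , refl

lasso : ∀ {m L} → (Fin (suc L) → Fin m → Bool) → Kripke m
lasso {L = L} ℓ = record
  { nStates = suc L
  ; δ       = λ s t → does (t ≟ lassoNext s)
  ; total   = λ s → lassoNext s , dec-true (lassoNext s ≟ lassoNext s) refl
  ; μ       = ℓ
  ; s₀      = zero
  }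

module _ {m L : ℕ} (ℓ : Fin (suc L) → Fin m → Bool) where

  lasso-initialPath : IsInitialPath (lasso ℓ) lassoPos
  lasso-initialPath =
    refl , λ i → dec-true (lassoPos {L} (suc i) ≟ lassoNext (lassoPos i)) (sym (lassoNext-lassoPos i))

  lasso-path : ∀ {π} → IsInitialPath (lasso ℓ) π → π ≗ lassoPos
  lasso-path (π₀ , _) zero = π₀
  lasso-path {π} init@(_ , step) (suc i) = begin
    π (suc i)                ≡⟨ does≡true⇒ (π (suc i) ≟ lassoNext (π i)) (step i) ⟩
    lassoNext (π i)          ≡⟨ cong lassoNext (lasso-path {π} init i) ⟩
    lassoNext (lassoPos i)   ≡⟨ lassoNext-lassoPos i ⟩
    lassoPos (suc i)         ∎
    where open ≡-Reasoning

  lasso-⊨ : ∀ φ → (lasso ℓ ⊨ φ) ⇔ _⊨LTL_ (lasso ℓ) lassoPos 0 φ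
  lasso-⊨ φ = mk⇔
    (λ holds → holds lassoPos lasso-initialPath)
    (λ holds π init → from (⊨LTL-cong-from (λ {i} _ p → cong (λ s → ℓ s p) (lasso-path {π} init i)) z≤n φ)
                             holds)

module _ {k : ℕ} where

  bitsOf : Fin (2 ^ k) → Fin k → Bool
  bitsOf s i = Inverse.to 2↔Bool (finToFun s i)

  fromBits : (Fin k → Bool) → Fin (2 ^ k)
  fromBits t = funToFin (Inverse.from 2↔Bool ∘ t)

  bitsOf-fromBits : ∀ t → bitsOf (fromBits t) ≗ t
  bitsOf-fromBits t i =
    trans (cong (Inverse.to 2↔Bool) (finToFun-funToFin _ i)) (Inverse.strictlyInverseˡ 2↔Bool (t i))

  fromBits-injective : ∀ {t t′} → fromBits t ≡ fromBits t′ → t ≗ t′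
  fromBits-injective {t} {t′} eq i =
    trans (sym (bitsOf-fromBits t i)) (trans (cong (λ s → bitsOf s i) eq) (bitsOf-fromBits t′ i))

funToFin-cong : ∀ {k n} {f g : Fin k → Fin n} → f ≗ g → funToFin f ≡ funToFin g
funToFin-cong {zero}  _   = refl
funToFin-cong {suc k} f≗g = cong₂ combine (f≗g zero) (funToFin-cong (f≗g ∘ suc))

bitsOf-injective : ∀ {k} {s s′ : Fin (2 ^ k)} → bitsOf s ≗ bitsOf s′ → s ≡ s′
bitsOf-injective {k} {s} {s′} same = begin
  s                                ≡⟨ funToFin-finToFin {k} {2} s ⟨
  funToFin (finToFun {2} {k} s)    ≡⟨ funToFin-cong finToFun-same ⟩
  funToFin (finToFun {2} {k} s′)   ≡⟨ funToFin-finToFin {k} {2} s′ ⟩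
  s′                               ∎
  where
  open ≡-Reasoning
  open Inverse 2↔Bool using (strictlyInverseʳ) renaming (from to fromBool)
  finToFun-same : finToFun {2} {k} s ≗ finToFun s′
  finToFun-same i = begin
    finToFun s i                     ≡⟨ strictlyInverseʳ (finToFun s i) ⟨
    fromBool (bitsOf s i)            ≡⟨ cong fromBool (same i) ⟩
    fromBool (bitsOf s′ i)           ≡⟨ strictlyInverseʳ (finToFun s′ i) ⟩
    finToFun s′ i                    ∎

does-≡⇒⇔ : ∀ {A B : Set} (a? : Dec A) (b? : Dec B) → does a? ≡ does b? → A ⇔ B
does-≡⇒⇔ (yes a) (yes b) _ = mk⇔ (const b) (const a)
does-≡⇒⇔ (no ¬a) (no ¬b) _ = mk⇔ (⊥-elim ∘ ¬a) (⊥-elim ∘ ¬b)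

Separates : ∀ {N k} → (Fin N → Fin k → Set) → Set
Separates Ty = ∀ s s′ → (∀ i → Ty s i ⇔ Ty s′ i) → s ≡ s′

¬¬-Π : ∀ {k} {P : Fin k → Set} → (∀ i → ¬ ¬ P i) → ¬ ¬ (∀ i → P i)
¬¬-Π = sequence (RawMonad.rawApplicative ¬¬-Monad)

-- Only a contradiction is sought, so the truth tables of the predicates may be
-- decided classically under a double negation; then pigeonhole applies.
¬separates : ∀ {N k} → 2 ^ k < N → (Ty : Fin N → Fin k → Set) → ¬ Separates Ty
¬separates 2^k<N Ty separates =
  ¬¬-Π (λ s → ¬¬-Π (λ i → ¬¬-excluded-middle)) λ (Ty? : ∀ s i → Dec (Ty s i)) →
  let truthTable = λ s → fromBits (λ i → does (Ty? s i))
      s , s′ , s<s′ , same = pigeonhole 2^k<N truthTable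
  in <-irreflᶠ (separates s s′ λ i → does-≡⇒⇔ (Ty? s i) (Ty? s′ i) (fromBits-injective same i)) s<s′

module _ {n : ℕ} where

  label : (Fin n → Bool) → (Fin (2 ^ n) → Bool) → Fin (suc (2 ^ n)) → Fin (suc n) → Bool
  label v Q zero    = true ∷ v
  label v Q (suc j) = Q j ∷ bitsOf j

  model : (Fin n → Bool) → (Fin (2 ^ n) → Bool) → Kripke (suc n)
  model v Q = lasso (label v Q)

  model-⊨lin-ψ : ∀ j Q → (model (bitsOf j) Q ⊨lin ψ n) ⇔ (Q j ≡ true)
  model-⊨lin-ψ j Q = mk⇔ holds⇒Qj Qj⇒holds
    where
    ℓ : Fin (suc (2 ^ n)) → Fin (suc n) → Bool
    ℓ = label (bitsOf j) Q
    ψ-at : Fin (suc (2 ^ n)) → Set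
    ψ-at s = (∀ k → bitsOf j k ≡ ℓ s (suc k)) → ℓ s zero ≡ true
    holds⇒Qj : model (bitsOf j) Q ⊨lin ψ n → Q j ≡ true
    holds⇒Qj holds = subst ψ-at (lassoPos-suc-toℕ j)
      (to (⊨-ψ (model _ Q) lassoPos z≤n) (holds lassoPos (lasso-initialPath ℓ) (suc (toℕ j))))
      (λ _ → refl)
    Qj⇒ψ-at : Q j ≡ true → ∀ s → ψ-at s
    Qj⇒ψ-at _  zero     _    = refl
    Qj⇒ψ-at Qj (suc j′) same = subst (λ x → Q x ≡ true) (bitsOf-injective same) Qj
    Qj⇒holds : Q j ≡ true → model (bitsOf j) Q ⊨lin ψ n
    Qj⇒holds Qj π (π₀ , _) i = from (⊨-ψ (model _ Q) π z≤n)
      (Qj⇒ψ-at Qj (π i) ∘ subst (λ s → ∀ k → ℓ s (suc k) ≡ ℓ (π i) (suc k)) π₀)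

  model-tail : ∀ v v′ Q ξ → _⊨LTL_ (model v Q) lassoPos 1 ξ ⇔ _⊨LTL_ (model v′ Q) lassoPos 1 ξ
  model-tail v v′ Q = ⊨LTL-cong-from sameAfter0 (s≤s z≤n)
    where
    sameAfter0 : ∀ {i} → 1 ≤ i → ∀ p → label v Q (lassoPos i) p ≡ label v′ Q (lassoPos i) p
    sameAfter0 {suc i} _ p with lassoPos-suc (m^n>0 2 n) i
    ... | _ , eq rewrite eq = refl

module _ {n : ℕ} (φ : LTL (suc n)) where

  -- By model-tail the initial valuation const false is immaterial.
  tailType : Fin (2 ^ 2 ^ n) → Fin (sizeLTL φ) → Set
  tailType s i = _⊨LTL_ (model (const false) (bitsOf s)) lassoPos 1 (subformulas φ i)

  model-⊨-tailType-cong : ∀ {s s′} → (∀ i → tailType s i ⇔ tailType s′ i) →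
                          ∀ v → (model v (bitsOf s) ⊨ φ) ⇔ (model v (bitsOf s′) ⊨ φ)
  model-⊨-tailType-cong {s} {s′} same v =
    ⇔-sym (lasso-⊨ _ φ) ⇔-∘ (⊨LTL-cong-step (λ _ → refl) φ sameTail ⇔-∘ lasso-⊨ _ φ)
    where
    sameTail : ∀ i → _⊨LTL_ (model v (bitsOf s)) lassoPos 1 (subformulas φ i) ⇔
                     _⊨LTL_ (model v (bitsOf s′)) lassoPos 1 (subformulas φ i)
    sameTail i = model-tail (const false) v (bitsOf s′) (subformulas φ i)
                 ⇔-∘ (same i ⇔-∘ model-tail v (const false) (bitsOf s) (subformulas φ i))

  tailType-separates : (∀ K → (K ⊨lin ψ n) ⇔ (K ⊨ φ)) → Separates tailType
  tailType-separates φ≡ψ s s′ same = bitsOf-injective λ j → ⇔→≡ (begin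
    bitsOf s j ≡ true                        ≈⟨ model-⊨lin-ψ j (bitsOf s) ⟨
    model (bitsOf j) (bitsOf s) ⊨lin ψ n     ≈⟨ φ≡ψ _ ⟩
    model (bitsOf j) (bitsOf s) ⊨ φ          ≈⟨ model-⊨-tailType-cong same (bitsOf j) ⟩
    model (bitsOf j) (bitsOf s′) ⊨ φ         ≈⟨ φ≡ψ _ ⟨
    model (bitsOf j) (bitsOf s′) ⊨lin ψ n    ≈⟨ model-⊨lin-ψ j (bitsOf s′) ⟩
    bitsOf s′ j ≡ true                       ∎)
    where open import Relation.Binary.Reasoning.Setoid (⇔-setoid 0ℓ)

  ψ-equivalent⇒2^n≤sizeLTL : (∀ K → (K ⊨lin ψ n) ⇔ (K ⊨ φ)) → 2 ^ n ≤ sizeLTL φ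
  ψ-equivalent⇒2^n≤sizeLTL φ≡ψ =
    ≮⇒≥ λ small → ¬separates (^-monoʳ-< 2 (s≤s (s≤s z≤n)) small) tailType (tailType-separates φ≡ψ)

module PolynomialGrowth where

  open import Data.List using (length; _∷_; [])
  open import Data.Nat.ListAction using (sum)
  open import Algebra.Properties.CommutativeSemigroup *-commutativeSemigroup using (x∙yz≈y∙xz)
  open ≤-Reasoning

  evalPoly-mono : ∀ P {x y} → x ≤ y → evalPoly P x ≤ evalPoly P y
  evalPoly-mono []       x≤y = z≤n
  evalPoly-mono (c ∷ cs) x≤y = +-monoʳ-≤ c (*-mono-≤ x≤y (evalPoly-mono cs x≤y))

  evalPoly≤sum*^length : ∀ P x .{{_ : NonZero x}} → evalPoly P x ≤ sum P * x ^ length P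
  evalPoly≤sum*^length []       x = z≤n
  evalPoly≤sum*^length (c ∷ cs) x = begin
    c + x * evalPoly cs x             ≤⟨ +-monoʳ-≤ c (*-monoʳ-≤ x (evalPoly≤sum*^length cs x)) ⟩
    c + x * (s * x ^ d)               ≡⟨ cong (c +_) (x∙yz≈y∙xz x s (x ^ d)) ⟩
    c + s * x ^ suc d                 ≤⟨ +-monoˡ-≤ _ (m≤m*n c (x ^ suc d) {{m^n≢0 x (suc d)}}) ⟩
    c * x ^ suc d + s * x ^ suc d     ≡⟨ *-distribʳ-+ (x ^ suc d) c s ⟨
    (c + s) * x ^ suc d               ∎
    where
    s d : ℕ
    s = sum cs
    d = length cs

  n+n≤2^n : ∀ n → n + n ≤ 2 ^ n
  n+n≤2^n 0             = z≤n
  n+n≤2^n 1             = ≤-refl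
  n+n≤2^n (suc (suc n)) = begin
    suc (suc n) + suc (suc n)   ≡⟨ cong suc (+-suc (suc n) (suc n)) ⟩
    2 + (suc n + suc n)         ≤⟨ +-mono-≤ (*-monoʳ-≤ 2 (m^n>0 2 n)) (n+n≤2^n (suc n)) ⟩
    2 ^ suc n + 2 ^ suc n       ≡⟨ cong (2 ^ suc n +_) (+-identityʳ (2 ^ suc n)) ⟨
    2 ^ suc (suc n)             ∎

  n≤2^n : ∀ n → n ≤ 2 ^ n
  n≤2^n n = ≤-trans (m≤m+n n n) (n+n≤2^n n)

  linear<2^ : ∀ a b → ∃ λ t → a + t * b < 2 ^ t
  linear<2^ a b = t , (begin-strict
    a + t * b         ≤⟨ +-monoˡ-≤ (t * b) (m≤n*m a t) ⟩
    t * a + t * b     ≡⟨ *-distribˡ-+ t a b ⟨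
    t * (a + b)       <⟨ *-monoʳ-< t (n<1+n (a + b)) ⟩
    t * u             ≤⟨ *-mono-≤ (n+n≤2^n u) (n≤2^n u) ⟩
    2 ^ u * 2 ^ u     ≡⟨ ^-distribˡ-+-* 2 u u ⟨
    2 ^ t             ∎)
    where
    u t : ℕ
    u = suc (a + b)
    t = u + u

  evalPoly<2^ : ∀ a P → ∃ λ n → 1 ≤ n × evalPoly P (a * n) < 2 ^ n
  evalPoly<2^ a P with linear<2^ (sum P + a * length P) (length P)
  ... | t , t-large = 2 ^ t , m^n>0 2 t , (begin-strict
    evalPoly P (a * 2 ^ t)            ≤⟨ evalPoly-mono P (*-monoˡ-≤ (2 ^ t) (n≤2^n a)) ⟩
    evalPoly P (2 ^ a * 2 ^ t)        ≡⟨ cong (evalPoly P) (^-distribˡ-+-* 2 a t) ⟨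
    evalPoly P (2 ^ (a + t))          ≤⟨ evalPoly≤sum*^length P (2 ^ (a + t)) {{m^n≢0 2 (a + t)}} ⟩
    s * (2 ^ (a + t)) ^ d             ≤⟨ *-monoˡ-≤ _ (n≤2^n s) ⟩
    2 ^ s * (2 ^ (a + t)) ^ d         ≡⟨ cong (2 ^ s *_) (^-*-assoc 2 (a + t) d) ⟩
    2 ^ s * 2 ^ ((a + t) * d)         ≡⟨ ^-distribˡ-+-* 2 s ((a + t) * d) ⟨
    2 ^ (s + (a + t) * d)             ≡⟨ cong (2 ^_) exponent ⟩
    2 ^ ((s + a * d) + t * d)         <⟨ ^-monoʳ-< 2 (s≤s (s≤s z≤n)) t-large ⟩
    2 ^ 2 ^ t                         ∎)
    where
    s d : ℕ
    s = sum P
    d = length P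
    exponent : s + (a + t) * d ≡ (s + a * d) + t * d
    exponent = trans (cong (s +_) (*-distribʳ-+ d a t)) (sym (+-assoc s (a * d) (t * d)))

open PolynomialGrowth using (evalPoly-mono; evalPoly<2^)

theorem15 : Σ (ℕ → ℕ) λ m → Σ ((n : ℕ) → HS (m n)) λ ψ →
              ∀ (P : Poly) → ∃ λ n → 1 ≤ n ×
                (∀ (φ : LTL (m n)) → sizeLTL φ ≤ evalPoly P (sizeHS (ψ n)) →
                  ¬ (∀ (K : Kripke (m n)) → (K ⊨lin ψ n) ⇔ (K ⊨ φ)))
theorem15 = suc , ψ , λ P →
  let n , 1≤n , evalPoly<2ⁿ = evalPoly<2^ 51 P in
  n , 1≤n , λ φ |φ|≤P[|ψ|] φ≡ψ →
    <⇒≱ (begin-strict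
      sizeLTL φ                  ≤⟨ |φ|≤P[|ψ|] ⟩
      evalPoly P (sizeHS (ψ n))  ≤⟨ evalPoly-mono P (sizeHS-ψ≤ 1≤n) ⟩
      evalPoly P (51 * n)        <⟨ evalPoly<2ⁿ ⟩
      2 ^ n                      ∎)
    (ψ-equivalent⇒2^n≤sizeLTL φ φ≡ψ)
  where open ≤-Reasoning
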